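{- Let $G \in \mathbb{R}^{N\times N}$ be a real symmetric matrix (weighted undirected graph) with vertex set $\mathbb{V} = \{1,\dots,N\}$ and two cospectral vertices $u,v \in \mathbb{V}$. Then: (i) For a subset $\mathbb{M} \subseteq \mathbb{V}$ and real weight tuple $\gamma = (\gamma_m)_{m\in\mathbb{M}}$, the vertices $u,v$ are cospectral in the weighted cone $H$ of $G$ over $\mathbb{M}$ with weight tuple $\gamma$ if and only if $\mathbb{M}_\gamma^p$ is a walk multiplet of $G$ relative to $u,v$ for some parity $p \in \{+1,-1\}$. (ii) For a vertex $c \in \mathbb{V}$, the vertices $u,v$ are cospectral in the graph $R = G\setminus c$ (the principal submatrix of $G$ obtained by deleting row and column $c$) if and only if $c$ is a walk singlet of $G$ relative to $u,v$ (with some parity $p\in\{+1,-1\}$).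
   Context: A real symmetric matrix $H \in \mathbb{R}^{n\times n}$ is identified with an undirected weighted graph on vertices $1,\dots,n$, with edge weight $H_{i,j}$ (diagonal entries are loops). Two vertices $u,v$ are cospectral in $H$ if $[H^k]_{u,u} = [H^k]_{v,v}$ for all integers $k \geq 0$. Given a vertex subset $\mathbb{M}$, a tuple $\gamma = (\gamma_m)_{m\in\mathbb{M}}$ of real numbers, and $p\in\{+1,-1\}$, $\mathbb{M}$ is a walk multiplet $\mathbb{M}_\gamma^p$ of $H$ relative to $u,v$ with parity $p$ if $\sum_{m\in\mathbb{M}}\gamma_m [H^k]_{u,m} = p\sum_{m\in\mathbb{M}}\gamma_m[H^k]_{v,m}$ for all $k \in\{0,\dots,n-1\}$ (equivalently for all integers $k\geq0$). A vertex $c$ is a walk singlet relative to $u,v$ with parity $p$ if $[H^k]_{u,c} = p[H^k]_{v,c}$ for all $k\ge 0$. The weighted cone of $G\in\mathbb{R}^{N\times N}$ over $\mathbb{M}$ with weight tuple $\gamma$ is $H = \begin{bmatrix} G & e_\mathbb{M}^\gamma\\ (e_\mathbb{M}^\gamma)^\top & 0\end{bmatrix}$, where $e_\mathbb{M}^\gamma\in\mathbb{R}^N$ has entries $\gamma_m$ for $m\in\mathbb{M}$ and $0$ otherwise. -}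

module Defs where

open import Level using (0ℓ) renaming (suc to lsuc)
open import Algebra.Bundles using (CommutativeRing)
open import Relation.Binary.Structures using (IsStrictTotalOrder)
open import Relation.Binary.Core using (Rel)
open import Relation.Nullary using (¬_)
open import Data.Product using (Σ; ∃; _×_; _,_)
open import Data.Nat as ℕ using (ℕ; zero; suc)
open import Data.Fin using (Fin; zero; suc; _≟_)
open import Data.Fin.Subset using (Subset)
open import Data.Vec using (lookup)
open import Data.Bool using (Bool; true; false; if_then_else_)
open import Data.Maybe using (Maybe; just; nothing)
import Data.Maybe as Maybe
open import Relation.Nullary.Decidable using (does)

-- The real numbers, axiomatised as a (Dedekind-)complete ordered field.
-- (agda-stdlib has no real numbers; every model of this record is the
-- field ℝ up to isomorphism, and the theorem is stated for every model.)

record RealField : Set₁ where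
  field
    commRing : CommutativeRing 0ℓ 0ℓ
  open CommutativeRing commRing public hiding (ring)
  field
    _<_           : Rel Carrier 0ℓ
    <-isSTO       : IsStrictTotalOrder _≈_ _<_
    0≉1           : ¬ (0# ≈ 1#)
    inv           : (x : Carrier) → ¬ (x ≈ 0#) → Carrier
    inv-cancel    : (x : Carrier) (x≉0 : ¬ (x ≈ 0#)) → x * inv x x≉0 ≈ 1#
    +-mono-<      : ∀ {x y} z → x < y → (x + z) < (y + z)
    *-pos         : ∀ {x y} → 0# < x → 0# < y → 0# < (x * y)
    sup           : (P : Carrier → Set) → Σ Carrier P →
                    Σ Carrier (λ b → ∀ x → P x → ¬ (b < x)) →
                    Σ Carrier (λ s → (∀ x → P x → ¬ (s < x)) ×
                                     (∀ b → (∀ x → P x → ¬ (b < x)) → ¬ (b < s)))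

module Matrices (ℝ : RealField) where
  open RealField ℝ using (Carrier; _≈_; _+_; _*_; -_; 0#; 1#) public

  Mat : ℕ → Set
  Mat N = Fin N → Fin N → Carrier

  Vector : ℕ → Set
  Vector N = Fin N → Carrier

  ∑ : ∀ {n} → (Fin n → Carrier) → Carrier
  ∑ {zero}  f = 0#
  ∑ {suc n} f = f zero + ∑ (λ i → f (suc i))

  Symmetric : ∀ {N} → Mat N → Set
  Symmetric G = ∀ i j → G i j ≈ G j i

  identity : ∀ {N} → Mat N
  identity i j = if does (i ≟ j) then 1# else 0#

  _⊗_ : ∀ {N} → Mat N → Mat N → Mat N
  (A ⊗ B) i j = ∑ (λ k → A i k * B k j)

  _^_ : ∀ {N} → Mat N → ℕ → Mat N
  H ^ zero  = identity
  H ^ suc k = H ⊗ (H ^ k)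

  Cospectral : ∀ {N} → Mat N → Fin N → Fin N → Set
  Cospectral H u v = ∀ k → (H ^ k) u u ≈ (H ^ k) v v

  data Parity : Set where
    +1ₚ -1ₚ : Parity

  sign : Parity → Carrier → Carrier
  sign +1ₚ x = x
  sign -1ₚ x = - x

  e[_,_] : ∀ {N} → Subset N → Vector N → Vector N
  e[ M , γ ] m = if lookup M m then γ m else 0#

  WalkMultiplet : ∀ {N} → Mat N → Fin N → Fin N → Subset N → Vector N → Parity → Set
  WalkMultiplet {N} H u v M γ p =
    ∀ k → k ℕ.< N →
      ∑ (λ m → e[ M , γ ] m * (H ^ k) u m) ≈ sign p (∑ (λ m → e[ M , γ ] m * (H ^ k) v m))

  WalkSinglet : ∀ {N} → Mat N → Fin N → Fin N → Fin N → Parity → Set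
  WalkSinglet H u v c p = ∀ k → (H ^ k) u c ≈ sign p ((H ^ k) v c)

  -- vertices of Fin (suc N): the old vertices 0..N-1 (just) and the new last vertex N (nothing)
  old? : ∀ {N} → Fin (suc N) → Maybe (Fin N)
  old? {zero}  zero    = nothing
  old? {suc N} zero    = just zero
  old? {suc N} (suc i) = Maybe.map suc (old? i)

  -- weighted cone  [[G , e] , [eᵀ , 0]]  with the cone vertex last
  cone : ∀ {N} → Mat N → Vector N → Mat (suc N)
  cone G e i j with old? i | old? j
  ... | just a  | just b  = G a b
  ... | just a  | nothing = e a
  ... | nothing | just b  = e b
  ... | nothing | nothing = 0#

module Submission where

-- Let A be symmetric with a distinguished vertex c, B = A \ c, and g the column of A at c
-- off c. Cutting a walk at its first and last visit to c gives, for the generating series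
-- of closed walks,
--   A_uu = B_uu + x² b_u² C,
-- where b_u(k) = (B^k g)_u counts walks from u that reach c only at their last step and
-- C (constant term 1) counts closed walks at c. So if u, v are cospectral in one of A, B,
-- they are cospectral in the other iff b_u² = b_v², i.e. (power series over a field form
-- an integral domain) iff b_u = ± b_v. The b_u(k) are coordinates of the Krylov iterates
-- B^k g, so agreement for k < N propagates to all k. For the cone, B = G and b_u(k) is
-- the walk-multiplet sum; for vertex deletion, A = G and the column A^(k+1)_uc = (b_u C)_k
-- turns b_u = ± b_v into the walk-singlet condition.

open import Algebra.Bundles using (CommutativeRing)
open import Data.Bool using (if_then_else_)
open import Data.Fin as F using (Fin; zero; suc; punchIn; punchOut; toℕ; fromℕ; inject₁)
open import Data.Fin.Patterns using (0F)
open import Data.Fin.Properties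
  using (toℕ<n; punchInᵢ≢i; punchIn-punchOut; punchIn-injective; all?; ¬∀⟶∃¬)
open import Data.Fin.Subset using (Subset)
open import Data.Maybe using (just; nothing)
open import Data.Nat as ℕ using (ℕ; zero; suc; _<_; _≤_; _∸_; z≤n; s≤s)
open import Data.Nat.Induction using (<-rec)
import Data.Nat.Properties as ℕ
open import Data.Product using (∃; _×_; _,_; map₂)
open import Data.Sum using (_⊎_; inj₁; inj₂)
open import Function using (_∘_)
open import Function.Bundles using (_⇔_; mk⇔; Equivalence)
open import Function.Construct.Symmetry using (⇔-sym)
open import Function.Properties.Equivalence using () renaming (trans to ⇔-trans)
open import Relation.Binary.Definitions using (Decidable)
open import Relation.Binary.PropositionalEquality as ≡ using (_≡_; _≢_)
open import Relation.Binary.Structures using (IsStrictTotalOrder)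
open import Relation.Nullary using (Dec; ¬_; ¬?; yes; no; contradiction)
open import Relation.Nullary.Decidable using (decidable-stable; dec-true; dec-false)

open import Defs

∃-⇔ : ∀ {A : Set} {P Q : A → Set} → (∀ x → P x ⇔ Q x) → ∃ P ⇔ ∃ Q
∃-⇔ P⇔Q = mk⇔ (map₂ (Equivalence.to (P⇔Q _))) (map₂ (Equivalence.from (P⇔Q _)))

punchIn-fromℕ : ∀ {n} (i : Fin n) → punchIn (fromℕ n) i ≡ inject₁ i
punchIn-fromℕ zero    = ≡.refl
punchIn-fromℕ (suc i) = ≡.cong suc (punchIn-fromℕ i)

module PowerSeries {c ℓ} (R : CommutativeRing c ℓ) where
  open CommutativeRing R hiding (zero)
  open import Algebra.Properties.Ring ring using (-‿distribˡ-*; -‿+-comm)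
  open import Algebra.Properties.Semiring.Sum semiring using (sum)
  open import Relation.Binary.Reasoning.Setoid setoid
  open import Algebra.Solver.Ring.NaturalCoefficients.Default commutativeSemiring
    using (solve; _:=_; _:+_; _:*_)

  Series : Set c
  Series = ℕ → Carrier

  infix 4 _≋_
  _≋_ : Series → Series → Set ℓ
  f ≋ g = ∀ k → f k ≈ g k

  0ₛ : Series
  0ₛ _ = 0#

  infixl 6 _+ₛ_ _-ₛ_
  infix  8 ⊝_
  infixr 7 _·ₛ_
  infixl 7 _⋆_

  ⊝_ : Series → Series
  (⊝ f) k = - f k

  _+ₛ_ _-ₛ_ : Series → Series → Series
  (f +ₛ g) k = f k + g k
  f -ₛ g = f +ₛ ⊝ g

  _·ₛ_ : Carrier → Series → Series
  (a ·ₛ f) k = a * f k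

  -- multiplication by the indeterminate
  shift : Series → Series
  shift f zero    = 0#
  shift f (suc k) = f k

  _⋆_ : Series → Series → Series
  (f ⋆ g) zero    = f 0 * g 0
  (f ⋆ g) (suc k) = f 0 * g (suc k) + (f ∘ suc ⋆ g) k

  ⋆-cong : ∀ {f f′ g g′} → f ≋ f′ → g ≋ g′ → f ⋆ g ≋ f′ ⋆ g′
  ⋆-cong f≋f′ g≋g′ zero    = *-cong (f≋f′ 0) (g≋g′ 0)
  ⋆-cong f≋f′ g≋g′ (suc k) =
    +-cong (*-cong (f≋f′ 0) (g≋g′ (suc k))) (⋆-cong (f≋f′ ∘ suc) g≋g′ k)

  ⋆-distribʳ-+ : ∀ f g h → (f +ₛ g) ⋆ h ≋ f ⋆ h +ₛ g ⋆ h
  ⋆-distribʳ-+ f g h zero    = distribʳ _ _ _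
  ⋆-distribʳ-+ f g h (suc k) = trans (+-congˡ (⋆-distribʳ-+ (f ∘ suc) (g ∘ suc) h k))
    (solve 5 (λ a b c d e → (a :+ b) :* c :+ (d :+ e) := (a :* c :+ d) :+ (b :* c :+ e)) refl _ _ _ _ _)

  ⊝-⋆ : ∀ f g → ⊝ f ⋆ g ≋ ⊝ (f ⋆ g)
  ⊝-⋆ f g zero    = sym (-‿distribˡ-* _ _)
  ⊝-⋆ f g (suc k) = trans (+-cong (sym (-‿distribˡ-* _ _)) (⊝-⋆ (f ∘ suc) g k)) (-‿+-comm _ _)

  -ₛ-⋆ : ∀ f g h → (f -ₛ g) ⋆ h ≋ f ⋆ h -ₛ g ⋆ h
  -ₛ-⋆ f g h k = trans (⋆-distribʳ-+ f (⊝ g) h k) (+-congˡ (⊝-⋆ g h k))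

  ·-⋆ : ∀ a f g → (a ·ₛ f) ⋆ g ≋ a ·ₛ (f ⋆ g)
  ·-⋆ a f g zero    = *-assoc _ _ _
  ·-⋆ a f g (suc k) = trans (+-congˡ (·-⋆ a (f ∘ suc) g k))
    (solve 4 (λ a b c d → a :* b :* c :+ a :* d := a :* (b :* c :+ d)) refl _ _ _ _)

  0-⋆ : ∀ g → 0ₛ ⋆ g ≋ 0ₛ
  0-⋆ g zero    = zeroˡ _
  0-⋆ g (suc k) = trans (+-cong (zeroˡ _) (0-⋆ g k)) (+-identityʳ 0#)

  ∑-⋆ : ∀ {n} (a : Fin n → Carrier) (F : Fin n → Series) g →
        (λ k → sum (λ w → a w * F w k)) ⋆ g ≋ (λ k → sum (λ w → a w * (F w ⋆ g) k))
  ∑-⋆ {zero}  a F g = 0-⋆ g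
  ∑-⋆ {suc n} a F g k = trans (⋆-distribʳ-+ (a 0F ·ₛ F 0F) _ g k)
    (+-cong (·-⋆ (a 0F) (F 0F) g k) (∑-⋆ (a ∘ suc) (F ∘ suc) g k))

  ⋆-comm : ∀ f g → f ⋆ g ≋ g ⋆ f
  ⋆-comm f g zero          = *-comm _ _
  ⋆-comm f g (suc zero)    = solve 4 (λ a b c d → a :* b :+ c :* d := d :* c :+ b :* a) refl _ _ _ _
  ⋆-comm f g (suc (suc k)) = begin
    f 0 * g (suc (suc k)) + (f ∘ suc ⋆ g) (suc k)
      ≈⟨ +-congˡ (⋆-comm (f ∘ suc) g (suc k)) ⟩
    f 0 * g (suc (suc k)) + (g 0 * f (suc (suc k)) + (g ∘ suc ⋆ f ∘ suc) k)
      ≈⟨ +-congˡ (+-congˡ (⋆-comm (g ∘ suc) (f ∘ suc) k)) ⟩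
    f 0 * g (suc (suc k)) + (g 0 * f (suc (suc k)) + (f ∘ suc ⋆ g ∘ suc) k)
      ≈⟨ solve 3 (λ a b c → a :+ (b :+ c) := b :+ (a :+ c)) refl _ _ _ ⟩
    g 0 * f (suc (suc k)) + (f 0 * g (suc (suc k)) + (f ∘ suc ⋆ g ∘ suc) k)
      ≈⟨ +-congˡ (⋆-comm (g ∘ suc) f (suc k)) ⟨
    (g ⋆ f) (suc (suc k)) ∎

  ⋆-distribˡ-+ : ∀ f g h → f ⋆ (g +ₛ h) ≋ f ⋆ g +ₛ f ⋆ h
  ⋆-distribˡ-+ f g h k = begin
    (f ⋆ (g +ₛ h)) k          ≈⟨ ⋆-comm f _ k ⟩
    ((g +ₛ h) ⋆ f) k          ≈⟨ ⋆-distribʳ-+ g h f k ⟩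
    (g ⋆ f) k + (h ⋆ f) k     ≈⟨ +-cong (⋆-comm g f k) (⋆-comm h f k) ⟩
    (f ⋆ g) k + (f ⋆ h) k     ∎

  ⋆-assoc : ∀ f g h → (f ⋆ g) ⋆ h ≋ f ⋆ (g ⋆ h)
  ⋆-assoc f g h zero    = *-assoc _ _ _
  ⋆-assoc f g h (suc k) = begin
    f 0 * g 0 * h (suc k) + (((f 0 ·ₛ g ∘ suc) +ₛ (f ∘ suc ⋆ g)) ⋆ h) k
      ≈⟨ +-congˡ (⋆-distribʳ-+ (f 0 ·ₛ g ∘ suc) (f ∘ suc ⋆ g) h k) ⟩
    f 0 * g 0 * h (suc k) + (((f 0 ·ₛ g ∘ suc) ⋆ h) k + ((f ∘ suc ⋆ g) ⋆ h) k)
      ≈⟨ +-congˡ (+-cong (·-⋆ (f 0) (g ∘ suc) h k) (⋆-assoc (f ∘ suc) g h k)) ⟩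
    f 0 * g 0 * h (suc k) + (f 0 * (g ∘ suc ⋆ h) k + (f ∘ suc ⋆ (g ⋆ h)) k)
      ≈⟨ solve 5 (λ a b c d e → a :* b :* c :+ (a :* d :+ e) := a :* (b :* c :+ d) :+ e) refl _ _ _ _ _ ⟩
    (f ⋆ (g ⋆ h)) (suc k) ∎

  shift-cong : ∀ {f g} → f ≋ g → shift f ≋ shift g
  shift-cong f≋g zero    = refl
  shift-cong f≋g (suc k) = f≋g k

  ⋆-shift : ∀ f g → f ⋆ shift g ≋ shift (f ⋆ g)
  ⋆-shift f g zero          = zeroʳ _
  ⋆-shift f g (suc zero)    = trans (+-congˡ (⋆-shift (f ∘ suc) g zero)) (+-identityʳ _)
  ⋆-shift f g (suc (suc k)) = +-congˡ (⋆-shift (f ∘ suc) g (suc k))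

  ⋆-vanishes : ∀ f g k → (∀ j → j ≤ k → g j ≈ 0#) → (f ⋆ g) k ≈ 0#
  ⋆-vanishes f g zero    g≈0 = trans (*-congˡ (g≈0 0 z≤n)) (zeroʳ _)
  ⋆-vanishes f g (suc k) g≈0 =
    trans (+-cong (trans (*-congˡ (g≈0 (suc k) ℕ.≤-refl)) (zeroʳ _))
                  (⋆-vanishes (f ∘ suc) g k (λ j j≤k → g≈0 j (ℕ.m≤n⇒m≤1+n j≤k))))
          (+-identityʳ 0#)

  ⋆-cancelˡ-0 : ∀ c f → (∀ x → c 0 * x ≈ 0# → x ≈ 0#) → c ⋆ f ≋ 0ₛ → f ≋ 0ₛ
  ⋆-cancelˡ-0 c f c₀-cancel cf≈0 = <-rec (λ k → f k ≈ 0#) step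
    where
    step : ∀ k → (∀ {j} → j < k → f j ≈ 0#) → f k ≈ 0#
    step zero    _  = c₀-cancel _ (cf≈0 0)
    step (suc k) ih = c₀-cancel _ (begin
      c 0 * f (suc k)         ≈⟨ +-identityʳ _ ⟨
      c 0 * f (suc k) + 0#    ≈⟨ +-congˡ (⋆-vanishes (c ∘ suc) f k (λ j j≤k → ih (s≤s j≤k))) ⟨
      (c ⋆ f) (suc k)         ≈⟨ cf≈0 (suc k) ⟩
      0#                      ∎)

  ⋆-⊝ : ∀ f g → f ⋆ ⊝ g ≋ ⊝ (f ⋆ g)
  ⋆-⊝ f g k = trans (⋆-comm f _ k) (trans (⊝-⋆ g f k) (-‿cong (⋆-comm g f k)))

  ⋆-difference-of-squares : ∀ f g → (f -ₛ g) ⋆ (f +ₛ g) ≋ f ⋆ f -ₛ g ⋆ g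
  ⋆-difference-of-squares f g k = begin
    ((f -ₛ g) ⋆ (f +ₛ g)) k
      ≈⟨ -ₛ-⋆ f g (f +ₛ g) k ⟩
    (f ⋆ (f +ₛ g)) k - (g ⋆ (f +ₛ g)) k
      ≈⟨ +-cong (⋆-distribˡ-+ f f g k) (-‿cong (⋆-distribˡ-+ g f g k)) ⟩
    ((f ⋆ f) k + (f ⋆ g) k) - ((g ⋆ f) k + (g ⋆ g) k)
      ≈⟨ +-congˡ (-‿cong (+-congʳ (⋆-comm g f k))) ⟩
    ((f ⋆ f) k + (f ⋆ g) k) - ((f ⋆ g) k + (g ⋆ g) k)
      ≈⟨ +-congˡ (-‿+-comm _ _) ⟨
    ((f ⋆ f) k + (f ⋆ g) k) + (- (f ⋆ g) k + - (g ⋆ g) k)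
      ≈⟨ solve 4 (λ a b b′ c → (a :+ b) :+ (b′ :+ c) := a :+ (b :+ b′) :+ c) refl _ _ _ _ ⟩
    (f ⋆ f) k + ((f ⋆ g) k - (f ⋆ g) k) - (g ⋆ g) k
      ≈⟨ +-congʳ (trans (+-congˡ (-‿inverseʳ _)) (+-identityʳ _)) ⟩
    (f ⋆ f) k - (g ⋆ g) k ∎

module _ (ℝ : RealField) where
  open RealField ℝ hiding (zero; _<_)
  open Matrices ℝ
    using ( Mat; Vector; ∑; Symmetric; identity; _⊗_; _^_; Cospectral; sign; +1ₚ; -1ₚ
          ; WalkSinglet; WalkMultiplet; e[_,_]; old?; cone)
  open PowerSeries commRing
  open import Algebra.Properties.Ring (CommutativeRing.ring commRing)
    using ( x∙y⁻¹≈ε⇒x≈y; -‿involutive; +-inverseʳ-unique; -1*x≈-x; -‿distribˡ-*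
          ; +-cancelˡ; +-cancelʳ; -0#≈0#)
  open import Algebra.Properties.CommutativeSemigroup +-commutativeSemigroup
    using () renaming (x∙yz≈y∙xz to x+[y+z]≈y+[x+z])
  open import Algebra.Properties.CommutativeSemigroup *-commutativeSemigroup using (x∙yz≈y∙xz)
  open import Algebra.Properties.Semiring.Sum semiring
    using (sum; sum-cong-≋; ∑-distrib-+; ∑-comm; sum-remove; *-distribˡ-sum; *-distribʳ-sum; sum-replicate-zero)
  open import Algebra.Solver.Ring.NaturalCoefficients.Default commutativeSemiring
    using (solve; _:=_; _:+_; _:*_)
  open import Relation.Binary.Reasoning.Setoid setoid

  -- Power series over a field

  _≈?_ : Decidable _≈_
  _≈?_ = IsStrictTotalOrder._≟_ <-isSTO

  *-cancelˡ-0 : ∀ {x y} → ¬ x ≈ 0# → x * y ≈ 0# → y ≈ 0#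
  *-cancelˡ-0 {x} {y} x≉0 xy≈0 = begin
    y                    ≈⟨ *-identityˡ y ⟨
    1# * y               ≈⟨ *-congʳ (trans (*-comm _ _) (inv-cancel x x≉0)) ⟨
    inv x x≉0 * x * y    ≈⟨ *-assoc _ _ _ ⟩
    inv x x≉0 * (x * y)  ≈⟨ *-congˡ xy≈0 ⟩
    inv x x≉0 * 0#       ≈⟨ zeroʳ _ ⟩
    0#                   ∎

  ⋆-noZeroDivisor : ∀ f g i → ¬ f i ≈ 0# → f ⋆ g ≋ 0ₛ → g ≋ 0ₛ
  ⋆-noZeroDivisor f g i fᵢ≉0 fg≈0 with f 0 ≈? 0#
  ... | no f₀≉0 = ⋆-cancelˡ-0 f g (λ _ → *-cancelˡ-0 f₀≉0) fg≈0
  ⋆-noZeroDivisor f g zero    fᵢ≉0 fg≈0 | yes f₀≈0 = contradiction f₀≈0 fᵢ≉0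
  ⋆-noZeroDivisor f g (suc i) fᵢ≉0 fg≈0 | yes f₀≈0 =
    ⋆-noZeroDivisor (f ∘ suc) g i fᵢ≉0 λ k → begin
      (f ∘ suc ⋆ g) k                       ≈⟨ +-identityˡ _ ⟨
      0# + (f ∘ suc ⋆ g) k                  ≈⟨ +-congʳ (trans (*-congʳ f₀≈0) (zeroˡ _)) ⟨
      (f ⋆ g) (suc k)                       ≈⟨ fg≈0 (suc k) ⟩
      0#                                    ∎

  ⋆-cancelʳ : ∀ f g h → ¬ h 0 ≈ 0# → f ⋆ h ≋ g ⋆ h → f ≋ g
  ⋆-cancelʳ f g h h₀≉0 fh≈gh k = x∙y⁻¹≈ε⇒x≈y _ _ (⋆-noZeroDivisor h (f -ₛ g) 0 h₀≉0 h[f-g]≈0 k)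
    where
    h[f-g]≈0 : h ⋆ (f -ₛ g) ≋ 0ₛ
    h[f-g]≈0 j = begin
      (h ⋆ (f -ₛ g)) j          ≈⟨ ⋆-comm h _ j ⟩
      ((f -ₛ g) ⋆ h) j          ≈⟨ -ₛ-⋆ f g h j ⟩
      (f ⋆ h) j - (g ⋆ h) j     ≈⟨ +-congʳ (fh≈gh j) ⟩
      (g ⋆ h) j - (g ⋆ h) j     ≈⟨ -‿inverseʳ _ ⟩
      0#                        ∎

  -- Equality of series is undecidable, so the sign can only be fixed on a finite prefix.
  ⋆-square-injective : ∀ f g → f ⋆ f ≋ g ⋆ g → ∀ n → ∃ λ p → ∀ k → k < n → f k ≈ sign p (g k)
  ⋆-square-injective f g ff≈gg n with ℕ.anyUpTo? (λ k → ¬? ((f -ₛ g) k ≈? 0#)) n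
  ... | no ∄k = +1ₚ , λ k k<n →
    x∙y⁻¹≈ε⇒x≈y _ _ (decidable-stable ((f -ₛ g) k ≈? 0#) (λ fₖ≉gₖ → ∄k (k , k<n , fₖ≉gₖ)))
  ... | yes (i , _ , fᵢ≉gᵢ) = -1ₚ , λ k _ → +-inverseʳ-unique _ _ (trans (+-comm _ _) (f+g≈0 k))
    where
    f+g≈0 : f +ₛ g ≋ 0ₛ
    f+g≈0 = ⋆-noZeroDivisor (f -ₛ g) (f +ₛ g) i fᵢ≉gᵢ λ k →
      trans (⋆-difference-of-squares f g k) (trans (+-congʳ (ff≈gg k)) (-‿inverseʳ _))

  sign-cong : ∀ p {x y} → x ≈ y → sign p x ≈ sign p y
  sign-cong +1ₚ x≈y = x≈y
  sign-cong -1ₚ x≈y = -‿cong x≈y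

  sign-0 : ∀ p → sign p 0# ≈ 0#
  sign-0 +1ₚ = refl
  sign-0 -1ₚ = -0#≈0#

  sign≈* : ∀ p x → sign p x ≈ sign p 1# * x
  sign≈* +1ₚ x = sym (*-identityˡ x)
  sign≈* -1ₚ x = sym (-1*x≈-x x)

  sign-⋆ : ∀ p f g → (sign p ∘ f) ⋆ g ≋ sign p ∘ (f ⋆ g)
  sign-⋆ +1ₚ f g k = refl
  sign-⋆ -1ₚ f g   = ⊝-⋆ f g

  sign-square : ∀ p f g → f ≋ sign p ∘ g → f ⋆ f ≋ g ⋆ g
  sign-square +1ₚ f g f≈g = ⋆-cong f≈g f≈g
  sign-square -1ₚ f g f≈-g k = begin
    (f ⋆ f) k          ≈⟨ ⋆-cong f≈-g f≈-g k ⟩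
    (⊝ g ⋆ ⊝ g) k      ≈⟨ ⊝-⋆ g (⊝ g) k ⟩
    - (g ⋆ ⊝ g) k      ≈⟨ -‿cong (⋆-⊝ g g k) ⟩
    - - (g ⋆ g) k      ≈⟨ -‿involutive _ ⟩
    (g ⋆ g) k          ∎

  -- Matrices

  sum-zero : ∀ n {x : Vector n} → (∀ i → x i ≈ 0#) → sum x ≈ 0#
  sum-zero n x≈0 = trans (sum-cong-≋ {n} x≈0) (sum-replicate-zero n)

  ∑≡sum : ∀ {n} (f : Vector n) → ∑ f ≡ sum f
  ∑≡sum {zero}  f = ≡.refl
  ∑≡sum {suc n} f = ≡.cong (f 0F +_) (∑≡sum (f ∘ suc))

  infix 4 _≈ᴹ_
  _≈ᴹ_ : ∀ {n} → Mat n → Mat n → Set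
  A ≈ᴹ B = ∀ i j → A i j ≈ B i j

  identity-≡ : ∀ {n} {i j : Fin n} → i ≡ j → identity i j ≡ 1#
  identity-≡ {i = i} {j} i≡j = ≡.cong (λ b → if b then 1# else 0#) (dec-true (i F.≟ j) i≡j)

  identity-≢ : ∀ {n} {i j : Fin n} → i ≢ j → identity i j ≡ 0#
  identity-≢ {i = i} {j} i≢j = ≡.cong (λ b → if b then 1# else 0#) (dec-false (i F.≟ j) i≢j)

  identity-sym : ∀ {n} (i j : Fin n) → identity i j ≡ identity j i
  identity-sym i j = by-cases (i F.≟ j)
    where
    by-cases : Dec (i ≡ j) → identity i j ≡ identity j i
    by-cases (yes i≡j) = ≡.trans (identity-≡ i≡j) (≡.sym (identity-≡ (≡.sym i≡j)))
    by-cases (no i≢j)  = ≡.trans (identity-≢ i≢j) (≡.sym (identity-≢ (i≢j ∘ ≡.sym)))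

  identity-punchIn : ∀ {n} (c : Fin (suc n)) (i j : Fin n) → identity (punchIn c i) (punchIn c j) ≡ identity i j
  identity-punchIn c i j = by-cases (i F.≟ j)
    where
    by-cases : Dec (i ≡ j) → identity (punchIn c i) (punchIn c j) ≡ identity i j
    by-cases (yes i≡j) = ≡.trans (identity-≡ (≡.cong (punchIn c) i≡j)) (≡.sym (identity-≡ i≡j))
    by-cases (no i≢j)  = ≡.trans (identity-≢ (i≢j ∘ punchIn-injective c i j)) (≡.sym (identity-≢ i≢j))

  sum-identityˡ : ∀ {n} (i : Fin n) (x : Vector n) → sum (λ k → identity i k * x k) ≈ x i
  sum-identityˡ {suc n} i x = begin
    sum (λ k → identity i k * x k)
      ≈⟨ sum-remove {i = i} (λ k → identity i k * x k) ⟩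
    identity i i * x i + sum (λ k → identity i (punchIn i k) * x (punchIn i k))
      ≈⟨ +-cong (*-congʳ (reflexive (identity-≡ {i = i} ≡.refl))) (sum-zero n off-diagonal) ⟩
    1# * x i + 0#
      ≈⟨ +-congʳ (*-identityˡ _) ⟩
    x i + 0#
      ≈⟨ +-identityʳ _ ⟩
    x i ∎
    where
    off-diagonal : ∀ k → identity i (punchIn i k) * x (punchIn i k) ≈ 0#
    off-diagonal k = trans (*-congʳ (reflexive (identity-≢ (punchInᵢ≢i i k ∘ ≡.sym)))) (zeroˡ _)

  sum-identityʳ : ∀ {n} (i : Fin n) (x : Vector n) → sum (λ k → x k * identity k i) ≈ x i
  sum-identityʳ i x = trans (sum-cong-≋ (λ k → trans (*-comm _ _) (*-congʳ (reflexive (identity-sym k i)))))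
                            (sum-identityˡ i x)

  ⊗-sum : ∀ {n} (A B : Mat n) i j → (A ⊗ B) i j ≈ sum (λ k → A i k * B k j)
  ⊗-sum A B i j = reflexive (∑≡sum (λ k → A i k * B k j))

  ⊗-cong : ∀ {n} {A A′ B B′ : Mat n} → A ≈ᴹ A′ → B ≈ᴹ B′ → A ⊗ B ≈ᴹ A′ ⊗ B′
  ⊗-cong {A = A} {A′} {B} {B′} A≈A′ B≈B′ i j = begin
    (A ⊗ B) i j                       ≈⟨ ⊗-sum A B i j ⟩
    sum (λ k → A i k * B k j)         ≈⟨ sum-cong-≋ (λ k → *-cong (A≈A′ i k) (B≈B′ k j)) ⟩
    sum (λ k → A′ i k * B′ k j)       ≈⟨ ⊗-sum A′ B′ i j ⟨
    (A′ ⊗ B′) i j                     ∎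

  ⊗-identityˡ : ∀ {n} (A : Mat n) → identity ⊗ A ≈ᴹ A
  ⊗-identityˡ A i j = trans (⊗-sum identity A i j) (sum-identityˡ i (λ k → A k j))

  ⊗-identityʳ : ∀ {n} (A : Mat n) → A ⊗ identity ≈ᴹ A
  ⊗-identityʳ A i j = trans (⊗-sum A identity i j) (sum-identityʳ j (A i))

  ⊗-assoc : ∀ {n} (A B C : Mat n) → (A ⊗ B) ⊗ C ≈ᴹ A ⊗ (B ⊗ C)
  ⊗-assoc A B C i j = begin
    ((A ⊗ B) ⊗ C) i j
      ≈⟨ ⊗-sum (A ⊗ B) C i j ⟩
    sum (λ k → (A ⊗ B) i k * C k j)
      ≈⟨ sum-cong-≋ (λ k → trans (*-congʳ (⊗-sum A B i k))
                                  (*-distribʳ-sum (C k j) (λ l → A i l * B l k))) ⟩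
    sum (λ k → sum (λ l → A i l * B l k * C k j))
      ≈⟨ ∑-comm (λ k l → A i l * B l k * C k j) ⟩
    sum (λ l → sum (λ k → A i l * B l k * C k j))
      ≈⟨ sum-cong-≋ (λ l → trans (sum-cong-≋ (λ k → *-assoc (A i l) (B l k) (C k j)))
                                  (sym (*-distribˡ-sum (A i l) (λ k → B l k * C k j)))) ⟩
    sum (λ l → A i l * sum (λ k → B l k * C k j))
      ≈⟨ sum-cong-≋ (λ l → *-congˡ (⊗-sum B C l j)) ⟨
    sum (λ l → A i l * (B ⊗ C) l j)
      ≈⟨ ⊗-sum A (B ⊗ C) i j ⟨
    (A ⊗ (B ⊗ C)) i j ∎

  ^-sucʳ : ∀ {n} (A : Mat n) k → A ^ suc k ≈ᴹ (A ^ k) ⊗ A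
  ^-sucʳ A zero    i j = trans (⊗-identityʳ A i j) (sym (⊗-identityˡ A i j))
  ^-sucʳ A (suc k) i j =
    trans (⊗-cong {A = A} {A′ = A} (λ _ _ → refl) (^-sucʳ A k) i j) (sym (⊗-assoc A (A ^ k) A i j))

  ^-symmetric : ∀ {n} {A : Mat n} → Symmetric A → ∀ k → Symmetric (A ^ k)
  ^-symmetric A-sym zero    i j = reflexive (identity-sym i j)
  ^-symmetric {A = A} A-sym (suc k) i j = begin
    (A ^ suc k) i j
      ≈⟨ ⊗-sum A (A ^ k) i j ⟩
    sum (λ z → A i z * (A ^ k) z j)
      ≈⟨ sum-cong-≋ (λ z → trans (*-cong (A-sym i z) (^-symmetric A-sym k z j)) (*-comm _ _)) ⟩
    sum (λ z → (A ^ k) j z * A z i)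
      ≈⟨ ⊗-sum (A ^ k) A j i ⟨
    ((A ^ k) ⊗ A) j i
      ≈⟨ ^-sucʳ A k j i ⟨
    (A ^ suc k) j i ∎

  -- Krylov iterates

  infixr 7 _·ᵥ_
  _·ᵥ_ : ∀ {n} → Mat n → Vector n → Vector n
  (A ·ᵥ x) i = sum (λ j → A i j * x j)

  ·ᵥ-combination : ∀ {n m} (A : Mat n) (c : Fin m → Carrier) (V : Fin m → Vector n) i →
                   (A ·ᵥ (λ l → sum (λ j → c j * V j l))) i ≈ sum (λ j → c j * (A ·ᵥ V j) i)
  ·ᵥ-combination A c V i = begin
    sum (λ l → A i l * sum (λ j → c j * V j l))
      ≈⟨ sum-cong-≋ (λ l → *-distribˡ-sum (A i l) (λ j → c j * V j l)) ⟩
    sum (λ l → sum (λ j → A i l * (c j * V j l)))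
      ≈⟨ ∑-comm (λ l j → A i l * (c j * V j l)) ⟩
    sum (λ j → sum (λ l → A i l * (c j * V j l)))
      ≈⟨ sum-cong-≋ (λ j → trans (sum-cong-≋ (λ l → x∙yz≈y∙xz (A i l) (c j) (V j l)))
                                  (sym (*-distribˡ-sum (c j) (λ l → A i l * V j l)))) ⟩
    sum (λ j → c j * (A ·ᵥ V j) i) ∎

  ≈-by-punchIn : ∀ {n} (r : Fin (suc n)) {x y : Vector (suc n)} →
                 x r ≈ y r → (∀ i → x (punchIn r i) ≈ y (punchIn r i)) → ∀ i → x i ≈ y i
  ≈-by-punchIn r {x} {y} xᵣ≈yᵣ x≈y i with i F.≟ r
  ... | yes ≡.refl = xᵣ≈yᵣ
  ... | no i≢r     =
    ≡.subst (λ i → x i ≈ y i) (punchIn-punchOut (i≢r ∘ ≡.sym)) (x≈y (punchOut (i≢r ∘ ≡.sym)))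

  zero-or-pivot : ∀ {n} (x : Vector n) → (∀ i → x i ≈ 0#) ⊎ ∃ λ r → ¬ x r ≈ 0#
  zero-or-pivot {n} x with all? (λ i → x i ≈? 0#)
  ... | yes x≈0 = inj₁ x≈0
  ... | no x≉0  = inj₂ (¬∀⟶∃¬ n _ (λ i → x i ≈? 0#) x≉0)

  DependsOnPredecessors : ∀ {n} → (ℕ → Vector n) → ℕ → Set
  DependsOnPredecessors y m = ∃ λ (c : Fin m → Carrier) → ∀ i → y m i ≈ sum (λ j → c j * y (toℕ j) i)

  sum-*-+-* : ∀ {m} (c a b : Fin m → Carrier) w →
              sum (λ j → c j * (a j + b j * w)) ≈ sum (λ j → c j * a j) + sum (λ j → c j * b j) * w
  sum-*-+-* c a b w = begin
    sum (λ j → c j * (a j + b j * w))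
      ≈⟨ sum-cong-≋ (λ j → trans (distribˡ (c j) _ _) (+-congˡ (sym (*-assoc (c j) (b j) w)))) ⟩
    sum (λ j → c j * a j + c j * b j * w)
      ≈⟨ ∑-distrib-+ (λ j → c j * a j) (λ j → c j * b j * w) ⟩
    sum (λ j → c j * a j) + sum (λ j → c j * b j * w)
      ≈⟨ +-congˡ (*-distribʳ-sum w (λ j → c j * b j)) ⟨
    sum (λ j → c j * a j) + sum (λ j → c j * b j) * w ∎

  -- Gaussian elimination of the coordinate r against the pivot entry y 0 r
  module Pivot {N} (y : ℕ → Vector (suc N)) (r : Fin (suc N)) (y₀ᵣ≉0 : ¬ y 0 r ≈ 0#) where
    ι : Carrier
    ι = inv (y 0 r) y₀ᵣ≉0

    ν : ℕ → Carrier
    ν j = - y j r * ι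

    ρ : ℕ → Vector (suc N)
    ρ j i = y j i + ν j * y 0 i

    ρ-pivot : ∀ j → ρ j r ≈ 0#
    ρ-pivot j = begin
      y j r + - y j r * ι * y 0 r      ≈⟨ +-congˡ (*-assoc _ _ _) ⟩
      y j r + - y j r * (ι * y 0 r)    ≈⟨ +-congˡ (*-congˡ (trans (*-comm _ _) (inv-cancel _ y₀ᵣ≉0))) ⟩
      y j r + - y j r * 1#             ≈⟨ +-congˡ (*-identityʳ _) ⟩
      y j r - y j r                    ≈⟨ -‿inverseʳ _ ⟩
      0#                               ∎

    reduced : ℕ → Vector N
    reduced j = ρ (suc j) ∘ punchIn r

    lift : ∀ {m} → DependsOnPredecessors reduced m → DependsOnPredecessors y (suc m)
    lift {m} (c , dep) = c′ , λ i → begin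
      y (suc m) i
        ≈⟨ y≈ρ-ν (suc m) i ⟩
      ρ (suc m) i - ν (suc m) * y 0 i
        ≈⟨ +-congʳ (ρ-dep i) ⟩
      sum (λ j → c j * ρ (suc (toℕ j)) i) - ν (suc m) * y 0 i
        ≈⟨ +-congʳ (sum-*-+-* c (λ j → y (suc (toℕ j)) i) (λ j → ν (suc (toℕ j))) (y 0 i)) ⟩
      S i + T * y 0 i - ν (suc m) * y 0 i
        ≈⟨ +-congˡ (-‿distribˡ-* _ _) ⟩
      S i + T * y 0 i + - ν (suc m) * y 0 i
        ≈⟨ solve 4 (λ s t n w → s :+ t :* w :+ n :* w := (t :+ n) :* w :+ s) refl (S i) T (- ν (suc m)) (y 0 i) ⟩
      (T - ν (suc m)) * y 0 i + S i ∎
      where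
      ρ-dep : ∀ i → ρ (suc m) i ≈ sum (λ j → c j * ρ (suc (toℕ j)) i)
      ρ-dep = ≈-by-punchIn r
        (trans (ρ-pivot (suc m)) (sym (sum-zero m (λ j → trans (*-congˡ (ρ-pivot _)) (zeroʳ _)))))
        dep
      y≈ρ-ν : ∀ k i → y k i ≈ ρ k i - ν k * y 0 i
      y≈ρ-ν k i = sym (trans (+-assoc _ _ _) (trans (+-congˡ (-‿inverseʳ _)) (+-identityʳ _)))
      S : Vector (suc N)
      S i = sum (λ j → c j * y (suc (toℕ j)) i)
      T : Carrier
      T = sum (λ j → c j * ν (suc (toℕ j)))
      c′ : Fin (suc m) → Carrier
      c′ zero    = T - ν (suc m)
      c′ (suc j) = c j

  dependsOnPredecessors-≤ : ∀ N (y : ℕ → Vector N) → ∃ λ m → m ≤ N × DependsOnPredecessors y m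
  dependsOnPredecessors-≤ zero    y = 0 , z≤n , (λ ()) , λ ()
  dependsOnPredecessors-≤ (suc N) y with zero-or-pivot (y 0)
  ... | inj₁ y₀≈0 = 0 , z≤n , (λ ()) , y₀≈0
  ... | inj₂ (r , y₀ᵣ≉0) with dependsOnPredecessors-≤ N (Pivot.reduced y r y₀ᵣ≉0)
  ...   | m , m≤N , dep = suc m , s≤s m≤N , Pivot.lift y r y₀ᵣ≉0 dep

  LinearlyClosed : ∀ {n} → (Vector n → Set) → Set
  LinearlyClosed {n} P = ∀ {m} (c : Fin m → Carrier) (V : Fin m → Vector n) {w : Vector n} →
                         (∀ j → P (V j)) → (∀ i → w i ≈ sum (λ j → c j * V j i)) → P w

  proportional-closed : ∀ {n} (u v : Fin n) s → LinearlyClosed (λ w → w u ≈ s * w v)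
  proportional-closed u v s c V {w} V-prop w≈∑ = begin
    w u
      ≈⟨ w≈∑ u ⟩
    sum (λ j → c j * V j u)
      ≈⟨ sum-cong-≋ (λ j → trans (*-congˡ (V-prop j)) (x∙yz≈y∙xz (c j) s (V j v))) ⟩
    sum (λ j → s * (c j * V j v))
      ≈⟨ *-distribˡ-sum s (λ j → c j * V j v) ⟨
    s * sum (λ j → c j * V j v)
      ≈⟨ *-congˡ (w≈∑ v) ⟨
    s * w v ∎

  -- Some x m with m ≤ N depends on its predecessors; applying B^t to that relation
  -- expresses every later iterate through earlier ones.
  krylov-closed : ∀ {N} (B : Mat N) (x : ℕ → Vector N) → (∀ k i → x (suc k) i ≈ (B ·ᵥ x k) i) →
                  ∀ {P} → LinearlyClosed P → (∀ k → k < N → P (x k)) → ∀ k → P (x k)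
  krylov-closed {N} B x x-step {P} closed P-init with dependsOnPredecessors-≤ N x
  ... | m , m≤N , c , dep = <-rec (P ∘ x) step
    where
    shifted : ∀ t i → x (t ℕ.+ m) i ≈ sum (λ j → c j * x (t ℕ.+ toℕ j) i)
    shifted zero    = dep
    shifted (suc t) i = begin
      x (suc (t ℕ.+ m)) i
        ≈⟨ x-step (t ℕ.+ m) i ⟩
      (B ·ᵥ x (t ℕ.+ m)) i
        ≈⟨ sum-cong-≋ (λ l → *-congˡ (shifted t l)) ⟩
      (B ·ᵥ (λ l → sum (λ j → c j * x (t ℕ.+ toℕ j) l))) i
        ≈⟨ ·ᵥ-combination B c (λ j → x (t ℕ.+ toℕ j)) i ⟩
      sum (λ j → c j * (B ·ᵥ x (t ℕ.+ toℕ j)) i)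
        ≈⟨ sum-cong-≋ {m} (λ j → *-congˡ (sym (x-step (t ℕ.+ toℕ j) i))) ⟩
      sum (λ j → c j * x (suc t ℕ.+ toℕ j) i) ∎
    step : ∀ k → (∀ {j} → j < k → P (x j)) → P (x k)
    step k ih with k ℕ.<? N
    ... | yes k<N = P-init k k<N
    ... | no k≮N  = ≡.subst (P ∘ x) (ℕ.m∸n+n≡m m≤k)
                      (closed c (λ j → x (k ∸ m ℕ.+ toℕ j)) (λ j → ih (earlier j)) (shifted (k ∸ m)))
      where
      m≤k : m ≤ k
      m≤k = ℕ.≤-trans m≤N (ℕ.≮⇒≥ k≮N)
      earlier : ∀ (j : Fin m) → k ∸ m ℕ.+ toℕ j < k
      earlier j = ≡.subst (k ∸ m ℕ.+ toℕ j <_) (ℕ.m∸n+n≡m m≤k) (ℕ.+-monoʳ-< (k ∸ m) (toℕ<n j))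

  krylov : ∀ {n} → Mat n → Vector n → ℕ → Vector n
  krylov B g zero    = g
  krylov B g (suc k) = B ·ᵥ krylov B g k

  krylov-walks : ∀ {n} (B : Mat n) (g : Vector n) k i → krylov B g k i ≈ sum (λ m → g m * (B ^ k) i m)
  krylov-walks B g zero    i = sym (trans (sum-cong-≋ (λ m → *-comm (g m) _)) (sum-identityˡ i g))
  krylov-walks B g (suc k) i = begin
    sum (λ w → B i w * krylov B g k w)
      ≈⟨ sum-cong-≋ (λ w → trans (*-congˡ (krylov-walks B g k w))
                                  (*-distribˡ-sum (B i w) (λ m → g m * (B ^ k) w m))) ⟩
    sum (λ w → sum (λ m → B i w * (g m * (B ^ k) w m)))
      ≈⟨ ∑-comm (λ w m → B i w * (g m * (B ^ k) w m)) ⟩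
    sum (λ m → sum (λ w → B i w * (g m * (B ^ k) w m)))
      ≈⟨ sum-cong-≋ (λ m → trans (sum-cong-≋ (λ w → x∙yz≈y∙xz (B i w) (g m) ((B ^ k) w m)))
                                  (sym (*-distribˡ-sum (g m) (λ w → B i w * (B ^ k) w m)))) ⟩
    sum (λ m → g m * sum (λ w → B i w * (B ^ k) w m))
      ≈⟨ sum-cong-≋ (λ m → *-congˡ (⊗-sum B (B ^ k) i m)) ⟨
    sum (λ m → g m * (B ^ suc k) i m) ∎

  -- Walks through a bordering vertex

  module Bordered {N} (A : Mat (suc N)) (c : Fin (suc N)) (B : Mat N) (g : Vector N)
                  (A≈B : ∀ i j → A (punchIn c i) (punchIn c j) ≈ B i j)
                  (A≈g : ∀ i → A (punchIn c i) c ≈ g i) (A-sym : Symmetric A) where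

    -- walks x k: weighted walks of length k + 1 from x to c that meet c only at the end
    walks : Fin N → Series
    walks x k = krylov B g k x

    returns : Series
    returns k = (A ^ k) c c

    ·ᵥ-punchIn : ∀ (y : Vector (suc N)) x →
                 (A ·ᵥ y) (punchIn c x) ≈ g x * y c + (B ·ᵥ (y ∘ punchIn c)) x
    ·ᵥ-punchIn y x = trans (sum-remove {i = c} (λ z → A (punchIn c x) z * y z))
                           (+-cong (*-congʳ (A≈g x)) (sum-cong-≋ (λ w → *-congʳ (A≈B x w))))

    -- Split a walk from punchIn c x at its first visit to c.
    first-passage : (X : ℕ → Vector (suc N)) (Y : ℕ → Vector N) →
                    (∀ k i → X (suc k) i ≈ (A ·ᵥ X k) i) → (∀ k i → Y (suc k) i ≈ (B ·ᵥ Y k) i) →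
                    (∀ x → Y 0 x ≈ X 0 (punchIn c x)) →
                    ∀ k x → X (suc k) (punchIn c x) ≈ Y (suc k) x + (walks x ⋆ (λ l → X l c)) k
    first-passage X Y X-step Y-step Y₀≈X₀ = go
      where
      Xc : Series
      Xc l = X l c
      go : ∀ k x → X (suc k) (punchIn c x) ≈ Y (suc k) x + (walks x ⋆ Xc) k
      go zero x = begin
        X 1 (punchIn c x)
          ≈⟨ X-step 0 (punchIn c x) ⟩
        (A ·ᵥ X 0) (punchIn c x)
          ≈⟨ ·ᵥ-punchIn (X 0) x ⟩
        g x * X 0 c + (B ·ᵥ (X 0 ∘ punchIn c)) x
          ≈⟨ +-comm _ _ ⟩
        (B ·ᵥ (X 0 ∘ punchIn c)) x + g x * X 0 c
          ≈⟨ +-congʳ (sum-cong-≋ (λ w → *-congˡ (Y₀≈X₀ w))) ⟨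
        (B ·ᵥ Y 0) x + g x * X 0 c
          ≈⟨ +-congʳ (Y-step 0 x) ⟨
        Y 1 x + (walks x ⋆ Xc) 0 ∎
      go (suc k) x = begin
        X (2 ℕ.+ k) (punchIn c x)
          ≈⟨ X-step (suc k) (punchIn c x) ⟩
        (A ·ᵥ X (suc k)) (punchIn c x)
          ≈⟨ ·ᵥ-punchIn (X (suc k)) x ⟩
        g x * Xc (suc k) + sum (λ w → B x w * X (suc k) (punchIn c w))
          ≈⟨ +-congˡ (sum-cong-≋ (λ w → trans (*-congˡ (go k w)) (distribˡ (B x w) _ _))) ⟩
        g x * Xc (suc k) + sum (λ w → B x w * Y (suc k) w + B x w * (walks w ⋆ Xc) k)
          ≈⟨ +-congˡ (∑-distrib-+ (λ w → B x w * Y (suc k) w) (λ w → B x w * (walks w ⋆ Xc) k)) ⟩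
        g x * Xc (suc k) + ((B ·ᵥ Y (suc k)) x + sum (λ w → B x w * (walks w ⋆ Xc) k))
          ≈⟨ +-congˡ (+-cong (sym (Y-step (suc k) x)) (sym (∑-⋆ (B x) walks Xc k))) ⟩
        g x * Xc (suc k) + (Y (2 ℕ.+ k) x + (walks x ∘ suc ⋆ Xc) k)
          ≈⟨ x+[y+z]≈y+[x+z] _ _ _ ⟩
        Y (2 ℕ.+ k) x + (walks x ⋆ Xc) (suc k) ∎

    column : ∀ k x → (A ^ suc k) (punchIn c x) c ≈ (walks x ⋆ returns) k
    column k x = trans
      (first-passage (λ l y → (A ^ l) y c) (λ _ _ → 0#)
        (λ k i → ⊗-sum A (A ^ k) i c)
        (λ k i → sym (sum-zero N (λ _ → zeroʳ _)))
        (λ x → sym (reflexive (identity-≢ (punchInᵢ≢i c x))))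
        k x)
      (+-identityˡ _)

    returns₀≉0 : ¬ returns 0 ≈ 0#
    returns₀≉0 = 0≉1 ∘ sym ∘ trans (sym (reflexive (identity-≡ {i = c} ≡.refl)))

    correction : Fin N → Series
    correction u = shift (shift ((walks u ⋆ walks u) ⋆ returns))

    diagonal : ∀ u k → (A ^ k) (punchIn c u) (punchIn c u) ≈ (B ^ k) u u + correction u k
    diagonal u zero = trans (reflexive (identity-punchIn c u u)) (sym (+-identityʳ _))
    diagonal u (suc k) = begin
      (A ^ suc k) (punchIn c u) (punchIn c u)
        ≈⟨ first-passage (λ l y → (A ^ l) y (punchIn c u)) (λ l x → (B ^ l) x u)
             (λ k i → ⊗-sum A (A ^ k) i (punchIn c u)) (λ k i → ⊗-sum B (B ^ k) i u)
             (λ x → reflexive (≡.sym (identity-punchIn c x u))) k u ⟩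
      (B ^ suc k) u u + (walks u ⋆ (λ l → (A ^ l) c (punchIn c u))) k
        ≈⟨ +-congˡ (⋆-cong (λ _ → refl) from-c k) ⟩
      (B ^ suc k) u u + (walks u ⋆ shift (walks u ⋆ returns)) k
        ≈⟨ +-congˡ (⋆-shift (walks u) (walks u ⋆ returns) k) ⟩
      (B ^ suc k) u u + shift (walks u ⋆ (walks u ⋆ returns)) k
        ≈⟨ +-congˡ (shift-cong (λ j → sym (⋆-assoc (walks u) (walks u) returns j)) k) ⟩
      (B ^ suc k) u u + correction u (suc k) ∎
      where
      from-c : (λ l → (A ^ l) c (punchIn c u)) ≋ shift (walks u ⋆ returns)
      from-c zero    = reflexive (identity-≢ (punchInᵢ≢i c u ∘ ≡.sym))
      from-c (suc l) = trans (^-symmetric A-sym (suc l) c (punchIn c u)) (column l u)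

    correction-≋ : ∀ u v → correction u ≋ correction v ⇔ walks u ⋆ walks u ≋ walks v ⋆ walks v
    correction-≋ u v = mk⇔
      (λ corr≋ → ⋆-cancelʳ _ _ returns returns₀≉0 (λ k → corr≋ (suc (suc k))))
      (λ sq≋ → shift-cong (shift-cong (⋆-cong sq≋ (λ _ → refl))))

    module _ (u v : Fin N) where
      private
        Aᵘᵛ Bᵘᵛ : Set
        Aᵘᵛ = Cospectral A (punchIn c u) (punchIn c v)
        Bᵘᵛ = Cospectral B u v

      correction-from-cospectral : Aᵘᵛ → Bᵘᵛ → correction u ≋ correction v
      correction-from-cospectral A-cosp B-cosp k = +-cancelˡ ((B ^ k) u u) _ _ (begin
        (B ^ k) u u + correction u k          ≈⟨ diagonal u k ⟨
        (A ^ k) (punchIn c u) (punchIn c u)   ≈⟨ A-cosp k ⟩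
        (A ^ k) (punchIn c v) (punchIn c v)   ≈⟨ diagonal v k ⟩
        (B ^ k) v v + correction v k          ≈⟨ +-congʳ (B-cosp k) ⟨
        (B ^ k) u u + correction v k          ∎)

      cospectral-bordered : Bᵘᵛ → Aᵘᵛ ⇔ walks u ⋆ walks u ≋ walks v ⋆ walks v
      cospectral-bordered B-cosp = mk⇔
        (λ A-cosp → Equivalence.to (correction-≋ u v) (correction-from-cospectral A-cosp B-cosp))
        (λ sq≋ k → begin
          (A ^ k) (punchIn c u) (punchIn c u) ≈⟨ diagonal u k ⟩
          (B ^ k) u u + correction u k        ≈⟨ +-cong (B-cosp k) (Equivalence.from (correction-≋ u v) sq≋ k) ⟩
          (B ^ k) v v + correction v k        ≈⟨ diagonal v k ⟨
          (A ^ k) (punchIn c v) (punchIn c v) ∎)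

      cospectral-principal : Aᵘᵛ → Bᵘᵛ ⇔ walks u ⋆ walks u ≋ walks v ⋆ walks v
      cospectral-principal A-cosp = mk⇔
        (λ B-cosp → Equivalence.to (correction-≋ u v) (correction-from-cospectral A-cosp B-cosp))
        (λ sq≋ k → +-cancelʳ (correction v k) ((B ^ k) u u) ((B ^ k) v v) (begin
          (B ^ k) u u + correction v k        ≈⟨ +-congˡ (Equivalence.from (correction-≋ u v) sq≋ k) ⟨
          (B ^ k) u u + correction u k        ≈⟨ diagonal u k ⟨
          (A ^ k) (punchIn c u) (punchIn c u) ≈⟨ A-cosp k ⟩
          (A ^ k) (punchIn c v) (punchIn c v) ≈⟨ diagonal v k ⟩
          (B ^ k) v v + correction v k        ∎))

    sign-extend : ∀ p u v → (∀ k → k < N → walks u k ≈ sign p (walks v k)) → walks u ≋ sign p ∘ walks v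
    sign-extend p u v prefix k = trans
      (krylov-closed B (krylov B g) (λ _ _ → refl) (proportional-closed u v (sign p 1#))
        (λ j j<N → trans (prefix j j<N) (sign≈* p _)) k)
      (sym (sign≈* p _))

    squares⇔sign : ∀ u v → walks u ⋆ walks u ≋ walks v ⋆ walks v ⇔ ∃ λ p → walks u ≋ sign p ∘ walks v
    squares⇔sign u v = mk⇔
      (λ sq≋ → let p , prefix = ⋆-square-injective (walks u) (walks v) sq≋ N in p , sign-extend p u v prefix)
      (λ (p , u≈±v) → sign-square p (walks u) (walks v) u≈±v)

    singlet⇔sign : ∀ p u v → WalkSinglet A (punchIn c u) (punchIn c v) c p ⇔ walks u ≋ sign p ∘ walks v
    singlet⇔sign p u v = mk⇔
      (λ singlet → ⋆-cancelʳ (walks u) (sign p ∘ walks v) returns returns₀≉0 λ k → begin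
        (walks u ⋆ returns) k                   ≈⟨ column k u ⟨
        (A ^ suc k) (punchIn c u) c             ≈⟨ singlet (suc k) ⟩
        sign p ((A ^ suc k) (punchIn c v) c)    ≈⟨ sign-cong p (column k v) ⟩
        sign p ((walks v ⋆ returns) k)          ≈⟨ sign-⋆ p (walks v) returns k ⟨
        ((sign p ∘ walks v) ⋆ returns) k        ∎)
      (λ u≈±v → λ where
        zero → trans (reflexive (identity-≢ (punchInᵢ≢i c u)))
                     (sym (trans (sign-cong p (reflexive (identity-≢ (punchInᵢ≢i c v)))) (sign-0 p)))
        (suc k) → begin
          (A ^ suc k) (punchIn c u) c             ≈⟨ column k u ⟩
          (walks u ⋆ returns) k                   ≈⟨ ⋆-cong u≈±v (λ _ → refl) k ⟩
          ((sign p ∘ walks v) ⋆ returns) k        ≈⟨ sign-⋆ p (walks v) returns k ⟩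
          sign p ((walks v ⋆ returns) k)          ≈⟨ sign-cong p (column k v) ⟨
          sign p ((A ^ suc k) (punchIn c v) c)    ∎)

    sign⇔prefix : ∀ p u v → walks u ≋ sign p ∘ walks v ⇔ (∀ k → k < N → walks u k ≈ sign p (walks v k))
    sign⇔prefix p u v = mk⇔ (λ u≈±v k _ → u≈±v k) (sign-extend p u v)

  -- Cones and vertex deletion

  old?-inject₁ : ∀ {n} (i : Fin n) → old? (inject₁ i) ≡ just i
  old?-inject₁ {suc n} zero    = ≡.refl
  old?-inject₁ {suc n} (suc i) rewrite old?-inject₁ i = ≡.refl

  old?-fromℕ : ∀ n → old? (fromℕ n) ≡ nothing
  old?-fromℕ zero    = ≡.refl
  old?-fromℕ (suc n) rewrite old?-fromℕ n = ≡.refl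

  cone-symmetric : ∀ {N} (G : Mat N) (e : Vector N) → Symmetric G → Symmetric (cone G e)
  cone-symmetric G e G-sym i j with old? i | old? j
  ... | just a  | just b  = G-sym a b
  ... | just _  | nothing = refl
  ... | nothing | just _  = refl
  ... | nothing | nothing = refl

  cone-cospectral : ∀ N (G : Mat N) (u v : Fin N) (M : Subset N) (γ : Vector N) →
                    Symmetric G → Cospectral G u v →
                    Cospectral (cone G e[ M , γ ]) (inject₁ u) (inject₁ v) ⇔ ∃ (WalkMultiplet G u v M γ)
  cone-cospectral N G u v M γ G-sym G-cosp =
    ≡.subst (_⇔ ∃ (WalkMultiplet G u v M γ))
            (≡.cong₂ (Cospectral (cone G e)) (punchIn-fromℕ u) (punchIn-fromℕ v))
      (⇔-trans (cospectral-bordered u v G-cosp)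
      (⇔-trans (squares⇔sign u v)
               (∃-⇔ (λ p → ⇔-trans (sign⇔prefix p u v) (multiplet⇔prefix p)))))
    where
    e : Vector N
    e = e[ M , γ ]
    cone≈G : ∀ i j → cone G e (punchIn (fromℕ N) i) (punchIn (fromℕ N) j) ≈ G i j
    cone≈G i j rewrite punchIn-fromℕ i | punchIn-fromℕ j | old?-inject₁ i | old?-inject₁ j = refl
    cone≈e : ∀ i → cone G e (punchIn (fromℕ N) i) (fromℕ N) ≈ e i
    cone≈e i rewrite punchIn-fromℕ i | old?-inject₁ i | old?-fromℕ N = refl
    open Bordered (cone G e) (fromℕ N) G e cone≈G cone≈e (cone-symmetric G e G-sym)
    walk-sum : ∀ k x → walks x k ≈ ∑ (λ m → e m * (G ^ k) x m)
    walk-sum k x = trans (krylov-walks G e k x) (reflexive (≡.sym (∑≡sum (λ m → e m * (G ^ k) x m))))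
    multiplet⇔prefix : ∀ p → (∀ k → k < N → walks u k ≈ sign p (walks v k)) ⇔ WalkMultiplet G u v M γ p
    multiplet⇔prefix p = mk⇔
      (λ prefix k k<N → trans (sym (walk-sum k u)) (trans (prefix k k<N) (sign-cong p (walk-sum k v))))
      (λ multiplet k k<N → trans (walk-sum k u) (trans (multiplet k k<N) (sign-cong p (sym (walk-sum k v)))))

  deletion-cospectral : ∀ N (G : Mat (suc N)) (c : Fin (suc N)) (u v : Fin N) →
                        Symmetric G → Cospectral G (punchIn c u) (punchIn c v) →
                        Cospectral (λ i j → G (punchIn c i) (punchIn c j)) u v
                          ⇔ ∃ (WalkSinglet G (punchIn c u) (punchIn c v) c)
  deletion-cospectral N G c u v G-sym G-cosp =
    ⇔-trans (cospectral-principal u v G-cosp)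
    (⇔-trans (squares⇔sign u v) (∃-⇔ (λ p → ⇔-sym (singlet⇔sign p u v))))
    where
    open Bordered G c (λ i j → G (punchIn c i) (punchIn c j)) (λ i → G (punchIn c i) c)
                  (λ _ _ → refl) (λ _ → refl) G-sym

theorem3 : (ℝ : RealField) → let open Matrices ℝ in
    -- (i) weighted cone
    (∀ (N : ℕ) (G : Mat N) (u v : Fin N) (M : Subset N) (γ : Vector N) →
       Symmetric G → Cospectral G u v →
       (Cospectral (cone G e[ M , γ ]) (inject₁ u) (inject₁ v)
         ⇔ ∃ (λ p → WalkMultiplet G u v M γ p)))
    ×
    -- (ii) vertex deletion: R = G \ c, vertices of R indexed via punchIn c
    (∀ (N : ℕ) (G : Mat (suc N)) (c : Fin (suc N)) (u′ v′ : Fin N) →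
       Symmetric G → Cospectral G (punchIn c u′) (punchIn c v′) →
       (Cospectral (λ i j → G (punchIn c i) (punchIn c j)) u′ v′
         ⇔ ∃ (λ p → WalkSinglet G (punchIn c u′) (punchIn c v′) c p)))
theorem3 ℝ = cone-cospectral ℝ , deletion-cospectral ℝ
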